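{- Let $(\mathcal C,\otimes,I,\gamma)$ be a symmetric monoidal category and $(\mathcal T,\eta,\mu,\tau)$ a centralisable strong monad on it; for each object $X$ let $(\mathcal ZX,\iota_X)$ be a terminal central cone of $\mathcal T$ at $X$, and equip $\mathcal Z$ with a commutative strong monad structure such that $\iota:\mathcal Z\Rightarrow\mathcal T$ is a monomorphism of strong monads (such a structure exists). Then the canonical embedding $\mathcal I:\mathcal C_{\mathcal Z}\to\mathcal C_{\mathcal T}$, given by $\mathcal I(X)=X$ and $\mathcal I(f:X\to\mathcal ZY)=\iota_Y\circ f$, corestricts to an isomorphism of categories $\mathcal C_{\mathcal Z}\cong Z(\mathcal C_{\mathcal T})$.
   Context: Right strength: $\tau'_{X,Y}=\mathcal T(\gamma_{Y,X})\circ\tau_{Y,X}\circ\gamma_{\mathcal TX,Y}$. A central cone of $\mathcal T$ at $X$ is a pair $(Z,\iota)$ with $\iota:Z\to\mathcal TX$ such that for every object $Y$, $\mu_{X\otimes Y}\circ\mathcal T\tau'_{X,Y}\circ\tau_{\mathcal TX,Y}\circ(\iota\otimes\mathrm{id}_{\mathcal TY})=\mu_{X\otimes Y}\circ\mathcal T\tau_{X,Y}\circ\tau'_{X,\mathcal TY}\circ(\iota\otimes\mathrm{id}_{\mathcal TY})$; a terminal central cone at $X$ is a terminal object of the category of central cones at $X$ (morphisms $\varphi$ with $\iota\circ\varphi=\iota'$); $\mathcal T$ is centralisable if terminal central cones exist at all objects. Kleisli category $\mathcal C_{\mathcal T}$: morphisms $X\to Y$ are morphisms $X\to\mathcal TY$,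 composition $g\odot f=\mu\circ\mathcal Tg\circ f$, identities $\eta$. For $f:X\to\mathcal TY$ and an object $W$: $f\otimes_l W=\tau'_{Y,W}\circ(f\otimes W)$, $W\otimes_r f=\tau_{W,Y}\circ(W\otimes f)$. A Kleisli morphism $f:X\to\mathcal TY$ is central if for all $f':X'\to\mathcal TY'$, $(Y\otimes_r f')\odot(f\otimes_l X')=(f\otimes_l Y')\odot(X\otimes_r f')$; $Z(\mathcal C_{\mathcal T})$ is the subcategory of $\mathcal C_{\mathcal T}$ with all objects and the central morphisms. Morphism of strong monads: natural $\iota$ with $\iota\circ\eta^{\mathcal Z}=\eta^{\mathcal T}$, $\iota\circ\mu^{\mathcal Z}=\mu^{\mathcal T}\circ\mathcal T\iota\circ\iota_{\mathcal Z}$, $\iota_{X\otimes Y}\circ\tau^{\mathcal Z}_{X,Y}=\tau^{\mathcal T}_{X,Y}\circ(X\otimes\iota_Y)$. -}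

module Defs where

open import Level using (Level; _⊔_) renaming (suc to lsuc)
open import Relation.Binary using (IsEquivalence)
open import Data.Product using (Σ; _×_; _,_)

record Category (o ℓ e : Level) : Set (lsuc (o ⊔ ℓ ⊔ e)) where
  infix  4 _≈_
  infixr 9 _∘_
  field
    Obj      : Set o
    _⇒_      : Obj → Obj → Set ℓ
    _≈_      : ∀ {A B} → A ⇒ B → A ⇒ B → Set e
    id       : ∀ {A} → A ⇒ A
    _∘_      : ∀ {A B C} → B ⇒ C → A ⇒ B → A ⇒ C
    equiv    : ∀ {A B} → IsEquivalence (_≈_ {A} {B})
    ∘-resp-≈ : ∀ {A B C} {f h : B ⇒ C} {g i : A ⇒ B} → f ≈ h → g ≈ i → f ∘ g ≈ h ∘ i
    assoc    : ∀ {A B C D} {f : A ⇒ B} {g : B ⇒ C} {h : C ⇒ D} → (h ∘ g) ∘ f ≈ h ∘ (g ∘ f)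
    identityˡ : ∀ {A B} {f : A ⇒ B} → id ∘ f ≈ f
    identityʳ : ∀ {A B} {f : A ⇒ B} → f ∘ id ≈ f

module _ {o ℓ e : Level} (C : Category o ℓ e) where
  open Category C

  IsMono : ∀ {A B} → A ⇒ B → Set (o ⊔ ℓ ⊔ e)
  IsMono {A} f = ∀ {W} (g h : W ⇒ A) → f ∘ g ≈ f ∘ h → g ≈ h

  record SymmetricMonoidal : Set (o ⊔ ℓ ⊔ e) where
    infixr 10 _⊗₀_ _⊗₁_
    field
      _⊗₀_ : Obj → Obj → Obj
      _⊗₁_ : ∀ {A B X Y} → A ⇒ B → X ⇒ Y → (A ⊗₀ X) ⇒ (B ⊗₀ Y)
      ⊗-identity : ∀ {A X} → id {A} ⊗₁ id {X} ≈ id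
      ⊗-homomorphism : ∀ {A B C' X Y Z} {f : A ⇒ B} {g : B ⇒ C'} {h : X ⇒ Y} {k : Y ⇒ Z} →
                       (g ∘ f) ⊗₁ (k ∘ h) ≈ (g ⊗₁ k) ∘ (f ⊗₁ h)
      ⊗-resp-≈ : ∀ {A B X Y} {f f' : A ⇒ B} {g g' : X ⇒ Y} → f ≈ f' → g ≈ g' → f ⊗₁ g ≈ f' ⊗₁ g'
      unit : Obj
      α     : ∀ {X Y Z} → ((X ⊗₀ Y) ⊗₀ Z) ⇒ (X ⊗₀ (Y ⊗₀ Z))
      α⁻¹   : ∀ {X Y Z} → (X ⊗₀ (Y ⊗₀ Z)) ⇒ ((X ⊗₀ Y) ⊗₀ Z)
      lam   : ∀ {X} → (unit ⊗₀ X) ⇒ X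
      lam⁻¹ : ∀ {X} → X ⇒ (unit ⊗₀ X)
      rho   : ∀ {X} → (X ⊗₀ unit) ⇒ X
      rho⁻¹ : ∀ {X} → X ⇒ (X ⊗₀ unit)
      γ     : ∀ {X Y} → (X ⊗₀ Y) ⇒ (Y ⊗₀ X)
      α-iso₁ : ∀ {X Y Z} → α⁻¹ {X} {Y} {Z} ∘ α ≈ id
      α-iso₂ : ∀ {X Y Z} → α {X} {Y} {Z} ∘ α⁻¹ ≈ id
      lam-iso₁ : ∀ {X} → lam⁻¹ {X} ∘ lam ≈ id
      lam-iso₂ : ∀ {X} → lam {X} ∘ lam⁻¹ ≈ id
      rho-iso₁ : ∀ {X} → rho⁻¹ {X} ∘ rho ≈ id
      rho-iso₂ : ∀ {X} → rho {X} ∘ rho⁻¹ ≈ id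
      α-natural : ∀ {X X' Y Y' Z Z'} {f : X ⇒ X'} {g : Y ⇒ Y'} {h : Z ⇒ Z'} →
                  α ∘ ((f ⊗₁ g) ⊗₁ h) ≈ (f ⊗₁ (g ⊗₁ h)) ∘ α
      lam-natural : ∀ {X Y} {f : X ⇒ Y} → lam ∘ (id ⊗₁ f) ≈ f ∘ lam
      rho-natural : ∀ {X Y} {f : X ⇒ Y} → rho ∘ (f ⊗₁ id) ≈ f ∘ rho
      γ-natural : ∀ {X X' Y Y'} {f : X ⇒ X'} {g : Y ⇒ Y'} → γ ∘ (f ⊗₁ g) ≈ (g ⊗₁ f) ∘ γ
      pentagon : ∀ {W X Y Z} →
                 (id {W} ⊗₁ α {X} {Y} {Z}) ∘ α {W} {X ⊗₀ Y} {Z} ∘ (α {W} {X} {Y} ⊗₁ id {Z})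
                   ≈ α {W} {X} {Y ⊗₀ Z} ∘ α {W ⊗₀ X} {Y} {Z}
      triangle : ∀ {X Y} → (id {X} ⊗₁ lam {Y}) ∘ α ≈ rho ⊗₁ id
      γ-involutive : ∀ {X Y} → γ {Y} {X} ∘ γ {X} {Y} ≈ id
      hexagon : ∀ {X Y Z} →
                α {Y} {Z} {X} ∘ γ {X} {Y ⊗₀ Z} ∘ α {X} {Y} {Z}
                  ≈ (id {Y} ⊗₁ γ {X} {Z}) ∘ α {Y} {X} {Z} ∘ (γ {X} {Y} ⊗₁ id {Z})

module _ {o ℓ e : Level} (C : Category o ℓ e) (M : SymmetricMonoidal C) where
  open Category C
  open SymmetricMonoidal M

  record StrongMonad : Set (o ⊔ ℓ ⊔ e) where
    field
      F₀ : Obj → Obj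
      F₁ : ∀ {A B} → A ⇒ B → F₀ A ⇒ F₀ B
      F-identity : ∀ {A} → F₁ (id {A}) ≈ id
      F-homomorphism : ∀ {A B C'} {f : A ⇒ B} {g : B ⇒ C'} → F₁ (g ∘ f) ≈ F₁ g ∘ F₁ f
      F-resp-≈ : ∀ {A B} {f g : A ⇒ B} → f ≈ g → F₁ f ≈ F₁ g
      η : ∀ X → X ⇒ F₀ X
      μ : ∀ X → F₀ (F₀ X) ⇒ F₀ X
      τ : ∀ X Y → (X ⊗₀ F₀ Y) ⇒ F₀ (X ⊗₀ Y)
      η-natural : ∀ {X Y} {f : X ⇒ Y} → η Y ∘ f ≈ F₁ f ∘ η X
      μ-natural : ∀ {X Y} {f : X ⇒ Y} → μ Y ∘ F₁ (F₁ f) ≈ F₁ f ∘ μ X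
      μ-assoc : ∀ {X} → μ X ∘ F₁ (μ X) ≈ μ X ∘ μ (F₀ X)
      μ-identityˡ : ∀ {X} → μ X ∘ F₁ (η X) ≈ id
      μ-identityʳ : ∀ {X} → μ X ∘ η (F₀ X) ≈ id
      τ-natural : ∀ {X X' Y Y'} {f : X ⇒ X'} {g : Y ⇒ Y'} →
                  τ X' Y' ∘ (f ⊗₁ F₁ g) ≈ F₁ (f ⊗₁ g) ∘ τ X Y
      τ-unitor : ∀ {X} → F₁ (lam {X}) ∘ τ unit X ≈ lam
      τ-assoc : ∀ {X Y Z} →
                F₁ (α {X} {Y} {Z}) ∘ τ (X ⊗₀ Y) Z ≈ τ X (Y ⊗₀ Z) ∘ (id ⊗₁ τ Y Z) ∘ α
      τ-η : ∀ {X Y} → τ X Y ∘ (id ⊗₁ η Y) ≈ η (X ⊗₀ Y)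
      τ-μ : ∀ {X Y} → τ X Y ∘ (id ⊗₁ μ Y) ≈ μ (X ⊗₀ Y) ∘ F₁ (τ X Y) ∘ τ X (F₀ Y)

  module _ (T : StrongMonad) where
    open StrongMonad T

    τ' : ∀ X Y → (F₀ X ⊗₀ Y) ⇒ F₀ (X ⊗₀ Y)
    τ' X Y = F₁ (γ {Y} {X}) ∘ τ Y X ∘ γ {F₀ X} {Y}

    IsCommutative : Set (o ⊔ e)
    IsCommutative = ∀ X Y →
      μ (X ⊗₀ Y) ∘ F₁ (τ' X Y) ∘ τ (F₀ X) Y ≈ μ (X ⊗₀ Y) ∘ F₁ (τ X Y) ∘ τ' X (F₀ Y)

    IsCentralCone : (X Z : Obj) → Z ⇒ F₀ X → Set (o ⊔ e)
    IsCentralCone X Z ι = ∀ Y →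
      μ (X ⊗₀ Y) ∘ F₁ (τ' X Y) ∘ τ (F₀ X) Y ∘ (ι ⊗₁ id {F₀ Y})
        ≈ μ (X ⊗₀ Y) ∘ F₁ (τ X Y) ∘ τ' X (F₀ Y) ∘ (ι ⊗₁ id {F₀ Y})

    IsTerminalCentralCone : (X Z : Obj) → Z ⇒ F₀ X → Set (o ⊔ ℓ ⊔ e)
    IsTerminalCentralCone X Z ι =
      IsCentralCone X Z ι ×
      (∀ W (κ : W ⇒ F₀ X) → IsCentralCone X W κ →
         Σ (W ⇒ Z) (λ φ → (ι ∘ φ ≈ κ) × (∀ (ψ : W ⇒ Z) → ι ∘ ψ ≈ κ → ψ ≈ φ)))

    Centralisable : Set (o ⊔ ℓ ⊔ e)
    Centralisable = ∀ X → Σ Obj (λ Z → Σ (Z ⇒ F₀ X) (λ ι → IsTerminalCentralCone X Z ι))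

    -- Kleisli category C_T: hom X → Y is X ⇒ T Y
    infixr 9 _⊙_
    _⊙_ : ∀ {X Y W} → Y ⇒ F₀ W → X ⇒ F₀ Y → X ⇒ F₀ W
    _⊙_ {W = W} g f = μ W ∘ F₁ g ∘ f

    kid : ∀ X → X ⇒ F₀ X
    kid X = η X

    _⊗ₗ_ : ∀ {X Y} → X ⇒ F₀ Y → ∀ W → (X ⊗₀ W) ⇒ F₀ (Y ⊗₀ W)
    _⊗ₗ_ {Y = Y} f W = τ' Y W ∘ (f ⊗₁ id {W})

    _⊗ᵣ_ : ∀ W → ∀ {X Y} → X ⇒ F₀ Y → (W ⊗₀ X) ⇒ F₀ (W ⊗₀ Y)
    _⊗ᵣ_ W {Y = Y} f = τ W Y ∘ (id {W} ⊗₁ f)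

    IsCentral : ∀ {X Y} → X ⇒ F₀ Y → Set (o ⊔ ℓ ⊔ e)
    IsCentral {X} {Y} f = ∀ {X' Y'} (f' : X' ⇒ F₀ Y') →
      (Y ⊗ᵣ f') ⊙ (f ⊗ₗ X') ≈ (f ⊗ₗ Y') ⊙ (X ⊗ᵣ f')

  module _ (Z T : StrongMonad) where
    private
      module Z = StrongMonad Z
      module T = StrongMonad T

    IsStrongMonadMorphism : (∀ X → Z.F₀ X ⇒ T.F₀ X) → Set (o ⊔ ℓ ⊔ e)
    IsStrongMonadMorphism ι =
      (∀ {X Y} (f : X ⇒ Y) → T.F₁ f ∘ ι X ≈ ι Y ∘ Z.F₁ f) ×
      (∀ X → ι X ∘ Z.η X ≈ T.η X) ×
      (∀ X → ι X ∘ Z.μ X ≈ T.μ X ∘ T.F₁ (ι X) ∘ ι (Z.F₀ X)) ×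
      (∀ X Y → ι (X ⊗₀ Y) ∘ Z.τ X Y ≈ T.τ X Y ∘ (id {X} ⊗₁ ι Y))

    IsStrongMonadMono : (∀ X → Z.F₀ X ⇒ T.F₀ X) → Set (o ⊔ ℓ ⊔ e)
    IsStrongMonadMono ι = IsStrongMonadMorphism ι × (∀ X → IsMono C (ι X))

-- A Kleisli morphism g : X → T Y is central exactly when (X , g) is a central cone of T at Y:
-- after rewriting with the naturality of the strengths, both conditions say that the two
-- double strengths T X ⊗ T Y → T (X ⊗ Y) agree after precomposition with g ⊗ f′, and this for
-- all f′ follows from the case f′ = id.  Hence ι ∘ f is central because central cones are
-- stable under precomposition, every central g factors through the terminal cone ι, and the
-- factorisation is unique because ι is monic.  Functoriality of f ↦ ι ∘ f holds since ι is a
-- morphism of monads.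

module Submission where

open import Level using (Level)
open import Data.Product using (Σ; _×_; _,_; proj₁; proj₂)
open import Relation.Binary.Bundles using (Setoid)
import Relation.Binary.Reasoning.Setoid as SetoidReasoning
import Defs
open Defs hiding (τ'; _⊙_)

module CategoryProperties {o ℓ e : Level} (C : Category o ℓ e) where
  open Category C

  hom-setoid : ∀ {A B} → Setoid ℓ e
  hom-setoid {A} {B} = record { Carrier = A ⇒ B ; _≈_ = _≈_ ; isEquivalence = equiv }

  module HomReasoning {A B : Obj} = SetoidReasoning (hom-setoid {A} {B})

  module _ {A B : Obj} where
    open Setoid (hom-setoid {A} {B}) public
      using () renaming (refl to ≈-refl; sym to ≈-sym; trans to ≈-trans)

  ∘-resp-≈ˡ : ∀ {A B D} {f h : B ⇒ D} {g : A ⇒ B} → f ≈ h → f ∘ g ≈ h ∘ g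
  ∘-resp-≈ˡ p = ∘-resp-≈ p ≈-refl

  ∘-resp-≈ʳ : ∀ {A B D} {f : B ⇒ D} {g i : A ⇒ B} → g ≈ i → f ∘ g ≈ f ∘ i
  ∘-resp-≈ʳ p = ∘-resp-≈ ≈-refl p

  sym-assoc : ∀ {A B D E} {f : A ⇒ B} {g : B ⇒ D} {h : D ⇒ E} → h ∘ (g ∘ f) ≈ (h ∘ g) ∘ f
  sym-assoc = ≈-sym assoc

module MonoidalProperties {o ℓ e : Level} {C : Category o ℓ e} (M : SymmetricMonoidal C) where
  open Category C
  open SymmetricMonoidal M
  open CategoryProperties C

  serialize₁₂ : ∀ {A B X Y} {f : A ⇒ B} {g : X ⇒ Y} → f ⊗₁ g ≈ (f ⊗₁ id) ∘ (id ⊗₁ g)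
  serialize₁₂ = ≈-trans (⊗-resp-≈ (≈-sym identityʳ) (≈-sym identityˡ)) ⊗-homomorphism

  serialize₂₁ : ∀ {A B X Y} {f : A ⇒ B} {g : X ⇒ Y} → f ⊗₁ g ≈ (id ⊗₁ g) ∘ (f ⊗₁ id)
  serialize₂₁ = ≈-trans (⊗-resp-≈ (≈-sym identityˡ) (≈-sym identityʳ)) ⊗-homomorphism

  split₁ˡ : ∀ {A B D X} {f : B ⇒ D} {g : A ⇒ B} → (f ∘ g) ⊗₁ id {X} ≈ (f ⊗₁ id) ∘ (g ⊗₁ id)
  split₁ˡ = ≈-trans (⊗-resp-≈ ≈-refl (≈-sym identityˡ)) ⊗-homomorphism

module StrongMonadProperties {o ℓ e : Level} {C : Category o ℓ e} {M : SymmetricMonoidal C}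
                             (T : StrongMonad C M) where
  open Category C
  open SymmetricMonoidal M
  open StrongMonad T
  open CategoryProperties C
  open MonoidalProperties M

  τ' : ∀ X Y → (F₀ X ⊗₀ Y) ⇒ F₀ (X ⊗₀ Y)
  τ' = Defs.τ' C M T

  infixr 9 _⊙_
  _⊙_ : ∀ {X Y W} → Y ⇒ F₀ W → X ⇒ F₀ Y → X ⇒ F₀ W
  _⊙_ = Defs._⊙_ C M T

  ⊙-∘ : ∀ {V X Y W} (g : Y ⇒ F₀ W) (f : X ⇒ F₀ Y) (h : V ⇒ X) → (g ⊙ f) ∘ h ≈ g ⊙ (f ∘ h)
  ⊙-∘ g f h = ≈-trans assoc (∘-resp-≈ʳ assoc)

  ⊙-slide : ∀ {X Y Y' W} (g : Y ⇒ F₀ W) (v : Y' ⇒ Y) {w : X ⇒ F₀ Y'} {w' : X ⇒ F₀ Y} →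
            F₁ v ∘ w ≈ w' → (g ∘ v) ⊙ w ≈ g ⊙ w'
  ⊙-slide g v {w} {w'} p = ∘-resp-≈ʳ (begin
      F₁ (g ∘ v) ∘ w     ≈⟨ ∘-resp-≈ˡ F-homomorphism ⟩
      (F₁ g ∘ F₁ v) ∘ w  ≈⟨ assoc ⟩
      F₁ g ∘ F₁ v ∘ w    ≈⟨ ∘-resp-≈ʳ p ⟩
      F₁ g ∘ w'          ∎)
    where open HomReasoning

  τ-naturalˡ : ∀ {X X' Y} {f : X ⇒ X'} → F₁ (f ⊗₁ id {Y}) ∘ τ X Y ≈ τ X' Y ∘ (f ⊗₁ id)
  τ-naturalˡ = ≈-trans (≈-sym τ-natural) (∘-resp-≈ʳ (⊗-resp-≈ ≈-refl F-identity))

  τ'-naturalʳ : ∀ {X Y Y'} {g : Y ⇒ Y'} → F₁ (id {X} ⊗₁ g) ∘ τ' X Y ≈ τ' X Y' ∘ (id ⊗₁ g)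
  τ'-naturalʳ {X} {Y} {Y'} {g} = begin
      F₁ (id ⊗₁ g) ∘ F₁ γ ∘ τ Y X ∘ γ        ≈⟨ sym-assoc ⟩
      (F₁ (id ⊗₁ g) ∘ F₁ γ) ∘ τ Y X ∘ γ      ≈⟨ ∘-resp-≈ˡ (≈-sym F-homomorphism) ⟩
      F₁ ((id ⊗₁ g) ∘ γ) ∘ τ Y X ∘ γ          ≈⟨ ∘-resp-≈ˡ (F-resp-≈ (≈-sym γ-natural)) ⟩
      F₁ (γ ∘ (g ⊗₁ id)) ∘ τ Y X ∘ γ          ≈⟨ ∘-resp-≈ˡ F-homomorphism ⟩
      (F₁ γ ∘ F₁ (g ⊗₁ id)) ∘ τ Y X ∘ γ      ≈⟨ ≈-trans assoc (∘-resp-≈ʳ sym-assoc) ⟩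
      F₁ γ ∘ (F₁ (g ⊗₁ id) ∘ τ Y X) ∘ γ      ≈⟨ ∘-resp-≈ʳ (∘-resp-≈ˡ τ-naturalˡ) ⟩
      F₁ γ ∘ (τ Y' X ∘ (g ⊗₁ id)) ∘ γ        ≈⟨ ∘-resp-≈ʳ assoc ⟩
      F₁ γ ∘ τ Y' X ∘ (g ⊗₁ id) ∘ γ          ≈⟨ ∘-resp-≈ʳ (∘-resp-≈ʳ (≈-sym γ-natural)) ⟩
      F₁ γ ∘ τ Y' X ∘ γ ∘ (id ⊗₁ g)          ≈⟨ ≈-trans (∘-resp-≈ʳ sym-assoc) sym-assoc ⟩
      (F₁ γ ∘ τ Y' X ∘ γ) ∘ (id ⊗₁ g)        ∎
    where open HomReasoning

  -- τ' ⊙ τ and τ ⊙ τ' are the two double strengths T X ⊗ T Y → T (X ⊗ Y);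
  -- T is commutative iff they agree, i.e. CommutesOn id.
  CommutesOn : ∀ {A X Y} → A ⇒ (F₀ X ⊗₀ F₀ Y) → Set e
  CommutesOn {X = X} {Y} h = (τ' X Y ⊙ τ (F₀ X) Y) ∘ h ≈ (τ X Y ⊙ τ' X (F₀ Y)) ∘ h

  commutesOn-resp-≈ : ∀ {A X Y} {h h' : A ⇒ (F₀ X ⊗₀ F₀ Y)} → h ≈ h' → CommutesOn h → CommutesOn h'
  commutesOn-resp-≈ h≈h' p =
    ≈-trans (∘-resp-≈ʳ (≈-sym h≈h')) (≈-trans p (∘-resp-≈ʳ h≈h'))

  commutesOn-∘ : ∀ {A B X Y} {h : B ⇒ (F₀ X ⊗₀ F₀ Y)} (k : A ⇒ B) → CommutesOn h → CommutesOn (h ∘ k)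
  commutesOn-∘ k p = ≈-trans sym-assoc (≈-trans (∘-resp-≈ˡ p) assoc)

  isCentralCone⇒commutesOn : ∀ {X W} {κ : W ⇒ F₀ X} → IsCentralCone C M T X W κ →
                             ∀ Y → CommutesOn (κ ⊗₁ id {F₀ Y})
  isCentralCone⇒commutesOn {X} {κ = κ} cone Y =
    ≈-trans (⊙-∘ _ _ (κ ⊗₁ id)) (≈-trans (cone Y) (≈-sym (⊙-∘ _ _ (κ ⊗₁ id))))

  commutesOn⇒isCentralCone : ∀ {X W} {κ : W ⇒ F₀ X} → (∀ Y → CommutesOn (κ ⊗₁ id {F₀ Y})) →
                             IsCentralCone C M T X W κ
  commutesOn⇒isCentralCone {κ = κ} p Y =
    ≈-trans (≈-sym (⊙-∘ _ _ (κ ⊗₁ id))) (≈-trans (p Y) (⊙-∘ _ _ (κ ⊗₁ id)))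

  ⊗ᵣ-after-⊗ₗ : ∀ {X Y X' Y'} (g : X ⇒ F₀ Y) (f' : X' ⇒ F₀ Y') →
                (τ Y Y' ∘ (id ⊗₁ f')) ⊙ (τ' Y X' ∘ (g ⊗₁ id)) ≈ (τ Y Y' ⊙ τ' Y (F₀ Y')) ∘ (g ⊗₁ f')
  ⊗ᵣ-after-⊗ₗ {X} {Y} {X'} {Y'} g f' =
    ≈-trans (⊙-slide (τ Y Y') (id ⊗₁ f') slide) (≈-sym (⊙-∘ (τ Y Y') (τ' Y (F₀ Y')) (g ⊗₁ f')))
    where
    open HomReasoning
    slide : F₁ (id ⊗₁ f') ∘ τ' Y X' ∘ (g ⊗₁ id) ≈ τ' Y (F₀ Y') ∘ (g ⊗₁ f')
    slide = begin
      F₁ (id ⊗₁ f') ∘ τ' Y X' ∘ (g ⊗₁ id)     ≈⟨ sym-assoc ⟩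
      (F₁ (id ⊗₁ f') ∘ τ' Y X') ∘ (g ⊗₁ id)   ≈⟨ ∘-resp-≈ˡ τ'-naturalʳ ⟩
      (τ' Y (F₀ Y') ∘ (id ⊗₁ f')) ∘ (g ⊗₁ id) ≈⟨ assoc ⟩
      τ' Y (F₀ Y') ∘ (id ⊗₁ f') ∘ (g ⊗₁ id)   ≈⟨ ∘-resp-≈ʳ (≈-sym serialize₂₁) ⟩
      τ' Y (F₀ Y') ∘ (g ⊗₁ f')                ∎

  ⊗ₗ-after-⊗ᵣ : ∀ {X Y X' Y'} (g : X ⇒ F₀ Y) (f' : X' ⇒ F₀ Y') →
                (τ' Y Y' ∘ (g ⊗₁ id)) ⊙ (τ X Y' ∘ (id ⊗₁ f')) ≈ (τ' Y Y' ⊙ τ (F₀ Y) Y') ∘ (g ⊗₁ f')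
  ⊗ₗ-after-⊗ᵣ {X} {Y} {X'} {Y'} g f' =
    ≈-trans (⊙-slide (τ' Y Y') (g ⊗₁ id) slide) (≈-sym (⊙-∘ (τ' Y Y') (τ (F₀ Y) Y') (g ⊗₁ f')))
    where
    open HomReasoning
    slide : F₁ (g ⊗₁ id) ∘ τ X Y' ∘ (id ⊗₁ f') ≈ τ (F₀ Y) Y' ∘ (g ⊗₁ f')
    slide = begin
      F₁ (g ⊗₁ id) ∘ τ X Y' ∘ (id ⊗₁ f')       ≈⟨ sym-assoc ⟩
      (F₁ (g ⊗₁ id) ∘ τ X Y') ∘ (id ⊗₁ f')     ≈⟨ ∘-resp-≈ˡ τ-naturalˡ ⟩
      (τ (F₀ Y) Y' ∘ (g ⊗₁ id)) ∘ (id ⊗₁ f')   ≈⟨ assoc ⟩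
      τ (F₀ Y) Y' ∘ (g ⊗₁ id) ∘ (id ⊗₁ f')     ≈⟨ ∘-resp-≈ʳ (≈-sym serialize₁₂) ⟩
      τ (F₀ Y) Y' ∘ (g ⊗₁ f')                  ∎

  isCentral⇒commutesOn : ∀ {X Y} {g : X ⇒ F₀ Y} → IsCentral C M T g →
                         ∀ {X' Y'} (f' : X' ⇒ F₀ Y') → CommutesOn (g ⊗₁ f')
  isCentral⇒commutesOn {g = g} central f' =
    ≈-trans (≈-sym (⊗ₗ-after-⊗ᵣ g f')) (≈-trans (≈-sym (central f')) (⊗ᵣ-after-⊗ₗ g f'))

  commutesOn⇒isCentral : ∀ {X Y} {g : X ⇒ F₀ Y} →
                         (∀ {X' Y'} (f' : X' ⇒ F₀ Y') → CommutesOn (g ⊗₁ f')) → IsCentral C M T g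
  commutesOn⇒isCentral {g = g} commutes f' =
    ≈-trans (⊗ᵣ-after-⊗ₗ g f') (≈-trans (≈-sym (commutes f')) (≈-sym (⊗ₗ-after-⊗ᵣ g f')))

  isCentral⇒isCentralCone : ∀ {X Y} {g : X ⇒ F₀ Y} → IsCentral C M T g → IsCentralCone C M T Y X g
  isCentral⇒isCentralCone central =
    commutesOn⇒isCentralCone (λ Y' → isCentral⇒commutesOn central (id {F₀ Y'}))

  -- g ⊗ f′ factors as (g ⊗ id) ∘ (id ⊗ f′), so the case f′ = id given by the cone suffices.
  isCentralCone⇒isCentral : ∀ {X Y} {g : X ⇒ F₀ Y} → IsCentralCone C M T Y X g → IsCentral C M T g
  isCentralCone⇒isCentral cone = commutesOn⇒isCentral λ {_} {Y'} f' →
    commutesOn-resp-≈ (≈-sym serialize₁₂) (commutesOn-∘ (id ⊗₁ f') (isCentralCone⇒commutesOn cone Y'))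

  isCentralCone-∘ : ∀ {X V W} {κ : W ⇒ F₀ X} → IsCentralCone C M T X W κ →
                    (h : V ⇒ W) → IsCentralCone C M T X V (κ ∘ h)
  isCentralCone-∘ cone h = commutesOn⇒isCentralCone λ Y →
    commutesOn-resp-≈ (≈-sym split₁ˡ) (commutesOn-∘ (h ⊗₁ id) (isCentralCone⇒commutesOn cone Y))

open Defs using (_⊙_)

module StrongMonadMorphismProperties {o ℓ e : Level} {C : Category o ℓ e} {M : SymmetricMonoidal C}
                                     {Z T : StrongMonad C M}
                                     {ι : ∀ X → Category._⇒_ C (StrongMonad.F₀ Z X) (StrongMonad.F₀ T X)}
                                     (morphism : IsStrongMonadMorphism C M Z T ι) where
  open Category C
  open CategoryProperties C
  private
    module Z = StrongMonad Z
    module T = StrongMonad T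

    natural : ∀ {X Y} (f : X ⇒ Y) → T.F₁ f ∘ ι X ≈ ι Y ∘ Z.F₁ f
    natural = proj₁ morphism

    μ-compatible : ∀ X → ι X ∘ Z.μ X ≈ T.μ X ∘ T.F₁ (ι X) ∘ ι (Z.F₀ X)
    μ-compatible = proj₁ (proj₂ (proj₂ morphism))

  ι-∘-⊙ : ∀ {X Y W} (f : X ⇒ Z.F₀ Y) (g : Y ⇒ Z.F₀ W) →
          ι W ∘ _⊙_ C M Z g f ≈ _⊙_ C M T (ι W ∘ g) (ι Y ∘ f)
  ι-∘-⊙ {X} {Y} {W} f g = begin
      ι W ∘ Z.μ W ∘ Z.F₁ g ∘ f                          ≈⟨ sym-assoc ⟩
      (ι W ∘ Z.μ W) ∘ Z.F₁ g ∘ f                        ≈⟨ ∘-resp-≈ˡ (μ-compatible W) ⟩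
      (T.μ W ∘ T.F₁ (ι W) ∘ ι (Z.F₀ W)) ∘ Z.F₁ g ∘ f    ≈⟨ ≈-trans assoc (∘-resp-≈ʳ (≈-trans assoc (∘-resp-≈ʳ sym-assoc))) ⟩
      T.μ W ∘ T.F₁ (ι W) ∘ (ι (Z.F₀ W) ∘ Z.F₁ g) ∘ f    ≈⟨ ∘-resp-≈ʳ (∘-resp-≈ʳ (∘-resp-≈ˡ (≈-sym (natural g)))) ⟩
      T.μ W ∘ T.F₁ (ι W) ∘ (T.F₁ g ∘ ι Y) ∘ f           ≈⟨ ∘-resp-≈ʳ (≈-trans (∘-resp-≈ʳ assoc) sym-assoc) ⟩
      T.μ W ∘ (T.F₁ (ι W) ∘ T.F₁ g) ∘ ι Y ∘ f           ≈⟨ ∘-resp-≈ʳ (∘-resp-≈ˡ (≈-sym T.F-homomorphism)) ⟩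
      T.μ W ∘ T.F₁ (ι W ∘ g) ∘ ι Y ∘ f                  ∎
    where open HomReasoning

mainTheorem7 : ∀ {o ℓ e : Level} (C : Category o ℓ e) (M : SymmetricMonoidal C)
                 (T : StrongMonad C M) → Centralisable C M T →
                 (Z : StrongMonad C M) (ι : ∀ X → Category._⇒_ C (StrongMonad.F₀ Z X) (StrongMonad.F₀ T X)) →
                 (∀ X → IsTerminalCentralCone C M T X (StrongMonad.F₀ Z X) (ι X)) →
                 IsCommutative C M Z →
                 IsStrongMonadMono C M Z T ι →
                 let open Category C
                     module Z = StrongMonad Z
                     module T = StrongMonad T
                     I : ∀ {X Y} → X ⇒ Z.F₀ Y → X ⇒ T.F₀ Y
                     I {Y = Y} f = ι Y ∘ f
                 in
                 -- I is a functor C_Z → C_T (identity on objects)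
                 (∀ X → I (kid C M Z X) ≈ kid C M T X) ×
                 (∀ {X Y W} (f : X ⇒ Z.F₀ Y) (g : Y ⇒ Z.F₀ W) →
                    I (_⊙_ C M Z g f) ≈ _⊙_ C M T (I g) (I f)) ×
                 (∀ {X Y} (f g : X ⇒ Z.F₀ Y) → f ≈ g → I f ≈ I g) ×
                 -- it corestricts to Z(C_T)
                 (∀ {X Y} (f : X ⇒ Z.F₀ Y) → IsCentral C M T (I f)) ×
                 -- and the corestriction is bijective on hom-setoids (and on objects)
                 (∀ {X Y} (f g : X ⇒ Z.F₀ Y) → I f ≈ I g → f ≈ g) ×
                 (∀ {X Y} (g : X ⇒ T.F₀ Y) → IsCentral C M T g →
                    Σ (X ⇒ Z.F₀ Y) (λ f → I f ≈ g))
mainTheorem7 C M T _ Z ι terminal _ (morphism@(_ , η-compatible , _) , mono) =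
    η-compatible
  , ι-∘-⊙
  , (λ f g → ∘-resp-≈ʳ)
  , (λ {_} {Y} f → isCentralCone⇒isCentral (isCentralCone-∘ (proj₁ (terminal Y)) f))
  , (λ {_} {Y} f g → mono Y f g)
  , λ {X} {Y} g central →
      let (f , ιf≈g , _) = proj₂ (terminal Y) X g (isCentral⇒isCentralCone central) in f , ιf≈g
  where
  open Category C
  open CategoryProperties C
  open StrongMonadProperties T
  open StrongMonadMorphismProperties {C = C} {M} {Z} {T} {ι} morphism
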